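{- Let $\phi:\mathbb{Z}\times\mathbb{Z}\to\mathbb{Z}_{13}$ be $\phi(x,y)=4x+7y \bmod 13$, and for $i\in\{0,\dots,12\}$ let $P(i)=\phi^{ -1}(i)$. For positive integers $m,n$, let $G_{m,n}$ denote a set of the form $\{(a,b)\in\mathbb{Z}\times\mathbb{Z}: a_0\le a\le a_0+n-1,\ b_0\le b\le b_0+m-1\}$ (an $m\times n$ block of lattice points). Let $\overline{m},\overline{n}\in\{0,\dots,12\}$ be the residues of $m,n$ modulo $13$, let \[\Phi=\{(2,7),(3,9),(4,4),(4,7),(4,10),(6,7),(6,9),(6,11),(7,2),(7,4),(7,6),(9,3),(9,6),(9,9),(10,4),(11,6)\},\] and let $\delta_\Phi=1$ if $(\overline{m},\overline{n})\in\Phi$ and $\delta_\Phi=0$ otherwise. Then \[\min_{0\le i\le 12}|G_{m,n}\cap P(i)|=\left\lfloor \frac{mn}{13}\right\rfloor-\delta_\Phi .\]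
   Context: The paper embeds $G_{m,n}$ in $\mathbb{Z}\times\mathbb{Z}$ as $\{(a,b): 2\le a\le n+1,\ 2\le b\le m+1\}$ and applies the statement also to the block $\{(a,b): 0\le a\le n+3,\ 0\le b\le m+3\}$; since the minimum is over all 13 translates $P(i)$, the position of the block does not matter. -}

module Defs where

open import Data.Nat as ℕ using (ℕ; _⊓_; _*_; _/_; _∸_; _%_)
open import Data.Integer as ℤ using (ℤ; +_; _%ℕ_)
open import Data.List using (List; []; _∷_; upTo; map; concatMap; filter; length)
open import Data.Bool using (Bool; true; false; if_then_else_)
open import Data.Product using (_×_; _,_)
open import Relation.Nullary.Decidable using (⌊_⌋)

φ : ℤ × ℤ → ℕ
φ (x , y) = (ℤ.+ 4 ℤ.* x ℤ.+ ℤ.+ 7 ℤ.* y) %ℕ 13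

-- G_{m,n} with corner (a₀,b₀): { (a,b) : a₀ ≤ a ≤ a₀+n-1, b₀ ≤ b ≤ b₀+m-1 },
-- enumerated as a duplicate-free list.
block : ℤ → ℤ → ℕ → ℕ → List (ℤ × ℤ)
block a₀ b₀ m n =
  concatMap (λ j → map (λ k → (a₀ ℤ.+ + j , b₀ ℤ.+ + k)) (upTo m)) (upTo n)

countP : ℤ → ℤ → ℕ → ℕ → ℕ → ℕ
countP a₀ b₀ m n i = length (filter (λ p → φ p ℕ.≟ i) (block a₀ b₀ m n))

min13 : (ℕ → ℕ) → ℕ
min13 f = go 12
  where
  go : ℕ → ℕ
  go ℕ.zero = f 0
  go (ℕ.suc k) = go k ⊓ f (ℕ.suc k)

Φ : List (ℕ × ℕ)
Φ = (2 , 7) ∷ (3 , 9) ∷ (4 , 4) ∷ (4 , 7) ∷ (4 , 10) ∷ (6 , 7) ∷ (6 , 9) ∷ (6 , 11)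
  ∷ (7 , 2) ∷ (7 , 4) ∷ (7 , 6) ∷ (9 , 3) ∷ (9 , 6) ∷ (9 , 9) ∷ (10 , 4) ∷ (11 , 6) ∷ []

memΦ : ℕ × ℕ → List (ℕ × ℕ) → Bool
memΦ _ [] = false
memΦ (u , v) ((p , q) ∷ rest) =
  if ⌊ u ℕ.≟ p ⌋ Data.Bool.∧ ⌊ v ℕ.≟ q ⌋ then true else memΦ (u , v) rest

δΦ : ℕ → ℕ → ℕ
δΦ m n = if memΦ (m % 13 , n % 13) Φ then 1 else 0

module Submission where

-- Put s = φ(a₀,b₀).  The point (a₀+j, b₀+k) of the block lies in
-- the class (s + 4j + 7k) mod 13, so |G_{m,n} ∩ P(i)| is a double sum of indicators
-- over j < n, k < m depending only on s (countP≡classCount).  Because 4 and 7 are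
-- units modulo 13, every 13 consecutive points of a row or of a column meet each class
-- exactly once; splitting m = 13⌊m/13⌋ + m̄ and n = 13⌊n/13⌋ + n̄ therefore shows that
-- every class count equals K + (the count for the m̄ × n̄ block), with
-- K = n⌊m/13⌋ + m̄⌊n/13⌋ independent of i (classCount-reduce).  The minimum over i
-- commutes with adding K, and ⌊mn/13⌋ = ⌊m̄n̄/13⌋ + K.  What remains is the theorem for
-- s, m̄, n̄ < 13, a finite table of 13³ instances that is checked by evaluation
-- (residueTable).

open import Defs
open import Data.Nat using (ℕ; NonZero; _*_; _/_; _∸_)
open import Data.Integer using (ℤ)
open import Relation.Binary.PropositionalEquality using (_≡_)

open import Data.Bool using (true; false; if_then_else_)
open import Data.Integer as ℤ using (+_; -[1+_]; -_; 1ℤ; _%ℕ_)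
open import Data.Integer.DivMod using (n%ℕd<d)
import Data.Integer.Properties as ℤP
open import Data.Integer.Tactic.RingSolver renaming (solve-∀ to ℤ-solve-∀)
open import Data.List using (List; _∷_; _++_; map; applyUpTo; concatMap; filter; length)
open import Data.List.Properties using (filter-++; length-++)
open import Data.Nat using (zero; suc; _+_; _%_; _≤_; _<_; _⊓_; _≡ᵇ_; _≟_; z≤n; s≤s; z<s; >-nonZero⁻¹)
open import Data.Nat.DivMod
open import Data.Nat.Divisibility using (divides)
open import Data.Nat.Properties
open import Algebra.Properties.CommutativeSemigroup +-commutativeSemigroup using (interchange)
open import Data.Nat.Tactic.RingSolver using (solve-∀)
open import Data.Product using (_×_; _,_)
open import Data.Sum using (inj₁; inj₂)
open import Relation.Binary.PropositionalEquality using (refl; sym; trans; cong; cong₂; module ≡-Reasoning)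
open import Relation.Nullary.Decidable using (toWitness)
open ≡-Reasoning

∑ : ℕ → (ℕ → ℕ) → ℕ
∑ zero    f = 0
∑ (suc n) f = f 0 + ∑ n (λ k → f (suc k))

syntax ∑ n (λ k → e) = ∑[ k < n ] e

∑-cong : ∀ n {f g : ℕ → ℕ} → (∀ k → f k ≡ g k) → ∑ n f ≡ ∑ n g
∑-cong zero    f≗g = refl
∑-cong (suc n) f≗g = cong₂ _+_ (f≗g 0) (∑-cong n (λ k → f≗g (suc k)))

∑-split : ∀ a b f → ∑ (a + b) f ≡ ∑ a f + ∑[ k < b ] f (a + k)
∑-split zero    b f = refl
∑-split (suc a) b f = trans (cong (_+_ (f 0)) (∑-split a b (λ k → f (suc k)))) (sym (+-assoc (f 0) _ _))

∑-distrib : ∀ n f g → ∑[ k < n ] (f k + g k) ≡ ∑ n f + ∑ n g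
∑-distrib zero    f g = refl
∑-distrib (suc n) f g =
  trans (cong (_+_ (f 0 + g 0)) (∑-distrib n (λ k → f (suc k)) (λ k → g (suc k))))
        (interchange (f 0) (g 0) _ _)

∑-const : ∀ n c → ∑ n (λ _ → c) ≡ n * c
∑-const zero    c = refl
∑-const (suc n) c = cong (_+_ c) (∑-const n c)

∑-comm : ∀ m n (F : ℕ → ℕ → ℕ) → ∑[ j < n ] ∑[ k < m ] F j k ≡ ∑[ k < m ] ∑[ j < n ] F j k
∑-comm m zero    F = sym (trans (∑-const m 0) (*-zeroʳ m))
∑-comm m (suc n) F =
  trans (cong (_+_ (∑ m (F 0))) (∑-comm m n (λ j k → F (suc j) k)))
        (sym (∑-distrib m (F 0) (λ k → ∑[ j < n ] F (suc j) k)))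

∑-periodic : ∀ p F → (∀ x → F (p + x) ≡ F x) → ∀ q r → ∑ (q * p + r) F ≡ q * ∑ p F + ∑ r F
∑-periodic p F periodic zero    r = refl
∑-periodic p F periodic (suc q) r = begin
  ∑ (p + q * p + r) F                         ≡⟨ cong (λ l → ∑ l F) (+-assoc p (q * p) r) ⟩
  ∑ (p + (q * p + r)) F                       ≡⟨ ∑-split p (q * p + r) F ⟩
  ∑ p F + ∑[ k < q * p + r ] F (p + k)        ≡⟨ cong (_+_ (∑ p F)) (∑-cong (q * p + r) periodic) ⟩
  ∑ p F + ∑ (q * p + r) F                     ≡⟨ cong (_+_ (∑ p F)) (∑-periodic p F periodic q r) ⟩
  ∑ p F + (q * ∑ p F + ∑ r F)                 ≡⟨ +-assoc (∑ p F) _ _ ⟨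
  ∑ p F + q * ∑ p F + ∑ r F                   ∎

∑-periodic-once : ∀ F → (∀ x → F (13 + x) ≡ F x) → ∑ 13 F ≡ 1 → ∀ n → ∑ n F ≡ n / 13 + ∑ (n % 13) F
∑-periodic-once F periodic once n = begin
  ∑ n F                                 ≡⟨ cong (λ l → ∑ l F) n≡q*13+r ⟩
  ∑ (n / 13 * 13 + n % 13) F            ≡⟨ ∑-periodic 13 F periodic (n / 13) (n % 13) ⟩
  n / 13 * ∑ 13 F + ∑ (n % 13) F        ≡⟨ cong (λ x → n / 13 * x + ∑ (n % 13) F) once ⟩
  n / 13 * 1 + ∑ (n % 13) F             ≡⟨ cong (_+ ∑ (n % 13) F) (*-identityʳ (n / 13)) ⟩
  n / 13 + ∑ (n % 13) F                 ∎
  where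
  n≡q*13+r : n ≡ n / 13 * 13 + n % 13
  n≡q*13+r = trans (m≡m%n+[m/n]*n n 13) (+-comm (n % 13) _)

-- minUpTo f k = min {f 0, …, f k}; by definition min13 f is minUpTo f 12.
minUpTo : (ℕ → ℕ) → ℕ → ℕ
minUpTo f zero    = f 0
minUpTo f (suc k) = minUpTo f k ⊓ f (suc k)

minUpTo-cong : ∀ {f g : ℕ → ℕ} k → (∀ {i} → i ≤ k → f i ≡ g i) → minUpTo f k ≡ minUpTo g k
minUpTo-cong zero    f≗g = f≗g z≤n
minUpTo-cong (suc k) f≗g = cong₂ _⊓_ (minUpTo-cong k (λ i≤k → f≗g (m≤n⇒m≤1+n i≤k))) (f≗g ≤-refl)

minUpTo-+ : ∀ c f k → minUpTo (λ i → c + f i) k ≡ c + minUpTo f k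
minUpTo-+ c f zero    = refl
minUpTo-+ c f (suc k) =
  trans (cong (_⊓ (c + f (suc k))) (minUpTo-+ c f k)) (sym (+-distribˡ-⊓ c _ _))

module Residues (d : ℕ) .{{_ : NonZero d}} where

  %-reduceˡ : ∀ m n → (m + n) % d ≡ (m % d + n) % d
  %-reduceˡ m n = begin
    (m + n) % d                ≡⟨ %-distribˡ-+ m n d ⟩
    (m % d + n % d) % d        ≡⟨ cong (λ x → (x + n % d) % d) (m%n%n≡m%n m d) ⟨
    (m % d % d + n % d) % d    ≡⟨ %-distribˡ-+ (m % d) n d ⟨
    (m % d + n) % d            ∎

  %-reduceʳ : ∀ m n → (m + n) % d ≡ (m + n % d) % d
  %-reduceʳ m n = begin
    (m + n) % d         ≡⟨ cong (_% d) (+-comm m n) ⟩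
    (n + m) % d         ≡⟨ %-reduceˡ n m ⟩
    (n % d + m) % d     ≡⟨ cong (_% d) (+-comm (n % d) m) ⟩
    (m + n % d) % d     ∎

  neg : ℕ → ℕ
  neg a = (d ∸ a % d) % d

  neg-suc : ∀ a → neg a ≡ suc (neg (suc a)) % d
  neg-suc a with m≤n⇒m<n∨m≡n (m%n<n a d)
  ... | inj₁ 1+r<d = begin
    (d ∸ r) % d                  ≡⟨ cong (_% d) (+-∸-assoc 1 1+r≤d) ⟩
    suc (d ∸ suc r) % d          ≡⟨ cong (λ x → suc x % d) (m<n⇒m%n≡m (∸-monoʳ-< z<s 1+r≤d)) ⟨
    suc ((d ∸ suc r) % d) % d    ≡⟨ cong (λ x → suc ((d ∸ x) % d) % d) [1+a]%d≡1+r ⟨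
    suc (neg (suc a)) % d        ∎
    where
    r : ℕ
    r = a % d
    1+r≤d : suc r ≤ d
    1+r≤d = <⇒≤ 1+r<d
    [1+a]%d≡1+r : suc a % d ≡ suc r
    [1+a]%d≡1+r = trans (%-reduceʳ 1 a) (m<n⇒m%n≡m 1+r<d)
  ... | inj₂ 1+r≡d = begin
    (d ∸ r) % d                  ≡⟨ cong (λ x → (x ∸ r) % d) 1+r≡d ⟨
    (suc r ∸ r) % d              ≡⟨ cong (_% d) (m+n∸n≡m 1 r) ⟩
    1 % d                        ≡⟨ cong (λ x → suc x % d) (n%n≡0 d) ⟨
    suc (d % d) % d              ≡⟨ cong (λ x → suc ((d ∸ x) % d) % d) [1+a]%d≡0 ⟨
    suc (neg (suc a)) % d        ∎
    where
    r : ℕ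
    r = a % d
    [1+a]%d≡0 : suc a % d ≡ 0
    [1+a]%d≡0 = trans (%-reduceʳ 1 a) (trans (cong (_% d) 1+r≡d) (n%n≡0 d))

  %ℕ-neg : ∀ n → (- + n) %ℕ d ≡ neg n
  %ℕ-neg zero = begin
    0 % d                ≡⟨ m<n⇒m%n≡m (>-nonZero⁻¹ d) ⟩
    0                    ≡⟨ n%n≡0 d ⟨
    d % d                ≡⟨ cong (λ x → (d ∸ x) % d) (m<n⇒m%n≡m (>-nonZero⁻¹ d)) ⟨
    neg 0                ∎
  %ℕ-neg (suc n) with suc n % d | m%n<n (suc n) d
  ... | zero  | _     = sym (n%n≡0 d)
  ... | suc r | 1+r<d = sym (m<n⇒m%n≡m (∸-monoʳ-< z<s (<⇒≤ 1+r<d)))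

  %ℕ-suc : ∀ x → (x ℤ.+ 1ℤ) %ℕ d ≡ suc (x %ℕ d) % d
  %ℕ-suc (+ n) = trans (cong (_% d) (+-comm n 1)) (%-reduceʳ 1 n)
  %ℕ-suc -[1+ n ] = begin
    (-[1+ n ] ℤ.+ 1ℤ) %ℕ d      ≡⟨ cong (_%ℕ d) (-[1+n]+1≡-n n) ⟩
    (- + n) %ℕ d                ≡⟨ %ℕ-neg n ⟩
    neg n                       ≡⟨ neg-suc n ⟩
    suc (neg (suc n)) % d       ≡⟨ cong (λ x → suc x % d) (%ℕ-neg (suc n)) ⟨
    suc (-[1+ n ] %ℕ d) % d     ∎
    where
    -[1+n]+1≡-n : ∀ n → -[1+ n ] ℤ.+ 1ℤ ≡ - + n
    -[1+n]+1≡-n zero    = refl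
    -[1+n]+1≡-n (suc n) = refl

  %ℕ-+ : ∀ x t → (x ℤ.+ + t) %ℕ d ≡ (x %ℕ d + t) % d
  %ℕ-+ x zero = begin
    (x ℤ.+ + 0) %ℕ d     ≡⟨ cong (_%ℕ d) (ℤP.+-identityʳ x) ⟩
    x %ℕ d               ≡⟨ m<n⇒m%n≡m (n%ℕd<d x d) ⟨
    x %ℕ d % d           ≡⟨ cong (_% d) (+-identityʳ (x %ℕ d)) ⟨
    (x %ℕ d + 0) % d     ∎
  %ℕ-+ x (suc t) = begin
    (x ℤ.+ + suc t) %ℕ d             ≡⟨ cong (_%ℕ d) x+[1+t]≡[x+t]+1 ⟩
    ((x ℤ.+ + t) ℤ.+ 1ℤ) %ℕ d        ≡⟨ %ℕ-suc (x ℤ.+ + t) ⟩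
    suc ((x ℤ.+ + t) %ℕ d) % d       ≡⟨ cong (λ y → suc y % d) (%ℕ-+ x t) ⟩
    suc ((x %ℕ d + t) % d) % d       ≡⟨ %-reduceʳ 1 (x %ℕ d + t) ⟨
    suc (x %ℕ d + t) % d             ≡⟨ cong (_% d) (+-suc (x %ℕ d) t) ⟨
    (x %ℕ d + suc t) % d             ∎
    where
    x+[1+t]≡[x+t]+1 : x ℤ.+ + suc t ≡ (x ℤ.+ + t) ℤ.+ 1ℤ
    x+[1+t]≡[x+t]+1 = trans (cong (ℤ._+_ x) (ℤP.+-comm 1ℤ (+ t))) (sym (ℤP.+-assoc x (+ t) 1ℤ))

open Residues 13 using (%-reduceˡ; %ℕ-+)

𝟙 : ℕ → ℕ → ℕ
𝟙 v i = if v ≡ᵇ i then 1 else 0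

module Count {A : Set} (v : A → ℕ) (i : ℕ) where

  # : List A → ℕ
  # xs = length (filter (λ x → v x ≟ i) xs)

  #-∷ : ∀ x xs → # (x ∷ xs) ≡ 𝟙 (v x) i + # xs
  #-∷ x xs with v x ≡ᵇ i
  ... | true  = refl
  ... | false = refl

  #-map-applyUpTo : ∀ (g : ℕ → A) (h : ℕ → ℕ) n → # (map g (applyUpTo h n)) ≡ ∑[ k < n ] 𝟙 (v (g (h k))) i
  #-map-applyUpTo g h zero    = refl
  #-map-applyUpTo g h (suc n) =
    trans (#-∷ (g (h 0)) _) (cong (_+_ (𝟙 (v (g (h 0))) i)) (#-map-applyUpTo g (λ k → h (suc k)) n))

  #-concatMap-applyUpTo : ∀ (F : ℕ → List A) (h : ℕ → ℕ) n → # (concatMap F (applyUpTo h n)) ≡ ∑[ j < n ] # (F (h j))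
  #-concatMap-applyUpTo F h zero    = refl
  #-concatMap-applyUpTo F h (suc n) = begin
    # (F (h 0) ++ rest)                        ≡⟨ cong length (filter-++ (λ x → v x ≟ i) (F (h 0)) rest) ⟩
    length (filter (λ x → v x ≟ i) (F (h 0))
            ++ filter (λ x → v x ≟ i) rest)    ≡⟨ length-++ (filter (λ x → v x ≟ i) (F (h 0))) ⟩
    # (F (h 0)) + # rest                       ≡⟨ cong (_+_ (# (F (h 0)))) (#-concatMap-applyUpTo F (λ k → h (suc k)) n) ⟩
    # (F (h 0)) + ∑[ j < n ] # (F (h (suc j))) ∎
    where
    rest : List A
    rest = concatMap F (applyUpTo (λ k → h (suc k)) n)

-- ψ s j k is the class of the point (a₀ + j, b₀ + k) when s = φ(a₀, b₀).
ψ : ℕ → ℕ → ℕ → ℕ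
ψ s j k = (s + (4 * j + 7 * k)) % 13

-- Translating a point by (j, k) adds 4j + 7k to its class; this reduces the integer
-- arithmetic of φ to arithmetic modulo 13 in ℕ.
φ-translate : ∀ a₀ b₀ j k → φ (a₀ ℤ.+ + j , b₀ ℤ.+ + k) ≡ ψ (φ (a₀ , b₀)) j k
φ-translate a₀ b₀ j k = begin
  (+ 4 ℤ.* (a₀ ℤ.+ + j) ℤ.+ + 7 ℤ.* (b₀ ℤ.+ + k)) %ℕ 13  ≡⟨ cong (_%ℕ 13) (regroup a₀ b₀ (+ j) (+ k)) ⟩
  (c ℤ.+ (+ 4 ℤ.* + j ℤ.+ + 7 ℤ.* + k)) %ℕ 13            ≡⟨ cong (λ z → (c ℤ.+ z) %ℕ 13) offset ⟨
  (c ℤ.+ + (4 * j + 7 * k)) %ℕ 13                        ≡⟨ %ℕ-+ c (4 * j + 7 * k) ⟩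
  ψ (φ (a₀ , b₀)) j k                                    ∎
  where
  c : ℤ
  c = + 4 ℤ.* a₀ ℤ.+ + 7 ℤ.* b₀
  regroup : ∀ a b x y → + 4 ℤ.* (a ℤ.+ x) ℤ.+ + 7 ℤ.* (b ℤ.+ y) ≡ (+ 4 ℤ.* a ℤ.+ + 7 ℤ.* b) ℤ.+ (+ 4 ℤ.* x ℤ.+ + 7 ℤ.* y)
  regroup = ℤ-solve-∀
  offset : + (4 * j + 7 * k) ≡ + 4 ℤ.* + j ℤ.+ + 7 ℤ.* + k
  offset = trans (ℤP.pos-+ (4 * j) (7 * k)) (cong₂ ℤ._+_ (ℤP.pos-* 4 j) (ℤP.pos-* 7 k))

classCount : ℕ → ℕ → ℕ → ℕ → ℕ
classCount s m n i = ∑[ j < n ] ∑[ k < m ] 𝟙 (ψ s j k) i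

countP≡classCount : ∀ a₀ b₀ m n i → countP a₀ b₀ m n i ≡ classCount (φ (a₀ , b₀)) m n i
countP≡classCount a₀ b₀ m n i =
  trans (#-concatMap-applyUpTo (λ j → map (point j) (applyUpTo (λ k → k) m)) (λ j → j) n)
        (∑-cong n (λ j → trans (#-map-applyUpTo (point j) (λ k → k) m)
                               (∑-cong m (λ k → cong (λ x → 𝟙 x i) (φ-translate a₀ b₀ j k)))))
  where
  open Count φ i
  point : ℕ → ℕ → ℤ × ℤ
  point j k = (a₀ ℤ.+ + j , b₀ ℤ.+ + k)

-- Since 13 is prime, for 0 < c < 13 the points t + c·k (k < 13) meet every class
-- modulo 13 exactly once; for t, c, i < 13 this is checked by evaluation.
lineTable : ∀ {c} → c < 12 → ∀ {t} → t < 13 → ∀ {i} → i < 13 → ∑[ k < 13 ] 𝟙 ((t + suc c * k) % 13) i ≡ 1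
lineTable = toWitness {a? = allUpTo? (λ c → allUpTo? (λ t → allUpTo? (λ i →
  ∑[ k < 13 ] 𝟙 ((t + suc c * k) % 13) i ≟ 1) 13) 13) 12} _

-- The same for arbitrary t, which enters only through its residue.
line-meets-each-class-once : ∀ c t {i} → 0 < c → c < 13 → i < 13 → ∑[ k < 13 ] 𝟙 ((t + c * k) % 13) i ≡ 1
line-meets-each-class-once zero    t () _ _
line-meets-each-class-once (suc c) t {i} _ (s≤s c<12) i<13 =
  trans (∑-cong 13 (λ k → cong (λ x → 𝟙 x i) (%-reduceˡ t (suc c * k))))
        (lineTable c<12 (m%n<n t 13) i<13)

column-once : ∀ s j {i} → i < 13 → ∑[ k < 13 ] 𝟙 (ψ s j k) i ≡ 1
column-once s j {i} i<13 =
  trans (∑-cong 13 (λ k → cong (λ x → 𝟙 (x % 13) i) (sym (+-assoc s (4 * j) (7 * k)))))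
        (line-meets-each-class-once 7 (s + 4 * j) z<s (toWitness {a? = 7 <? 13} _) i<13)

row-once : ∀ s k {i} → i < 13 → ∑[ j < 13 ] 𝟙 (ψ s j k) i ≡ 1
row-once s k {i} i<13 =
  trans (∑-cong 13 (λ j → cong (λ x → 𝟙 (x % 13) i) (reorder s j k)))
        (line-meets-each-class-once 4 (s + 7 * k) z<s (toWitness {a? = 4 <? 13} _) i<13)
  where
  reorder : ∀ s j k → s + (4 * j + 7 * k) ≡ s + 7 * k + 4 * j
  reorder = solve-∀

ψ-periodicʲ : ∀ s j k → ψ s (13 + j) k ≡ ψ s j k
ψ-periodicʲ s j k = trans (cong (_% 13) (full-period s j k)) ([m+kn]%n≡m%n (s + (4 * j + 7 * k)) 4 13)
  where
  full-period : ∀ s j k → s + (4 * (13 + j) + 7 * k) ≡ s + (4 * j + 7 * k) + 4 * 13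
  full-period = solve-∀

ψ-periodicᵏ : ∀ s j k → ψ s j (13 + k) ≡ ψ s j k
ψ-periodicᵏ s j k = trans (cong (_% 13) (full-period s j k)) ([m+kn]%n≡m%n (s + (4 * j + 7 * k)) 7 13)
  where
  full-period : ∀ s j k → s + (4 * j + 7 * (13 + k)) ≡ s + (4 * j + 7 * k) + 7 * 13
  full-period = solve-∀

-- The number of points of each class contributed by the full periods of an m × n block.
periods : ℕ → ℕ → ℕ
periods m n = n * (m / 13) + m % 13 * (n / 13)

classCount-reduce : ∀ s m n {i} → i < 13 → classCount s m n i ≡ periods m n + classCount s (m % 13) (n % 13) i
classCount-reduce s m n {i} i<13 = begin
  ∑[ j < n ] ∑[ k < m ] X j k                          ≡⟨ ∑-cong n (λ j → columns j) ⟩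
  ∑[ j < n ] (m / 13 + ∑[ k < r ] X j k)               ≡⟨ ∑-distrib n (λ _ → m / 13) _ ⟩
  ∑ n (λ _ → m / 13) + ∑[ j < n ] ∑[ k < r ] X j k     ≡⟨ cong₂ _+_ (∑-const n (m / 13)) (∑-comm r n X) ⟩
  n * (m / 13) + ∑[ k < r ] ∑[ j < n ] X j k           ≡⟨ cong (_+_ (n * (m / 13))) (∑-cong r rows) ⟩
  n * (m / 13) + ∑[ k < r ] (n / 13 + ∑[ j < r' ] X j k)
    ≡⟨ cong (_+_ (n * (m / 13))) (∑-distrib r (λ _ → n / 13) _) ⟩
  n * (m / 13) + (∑ r (λ _ → n / 13) + ∑[ k < r ] ∑[ j < r' ] X j k)
    ≡⟨ cong (_+_ (n * (m / 13))) (cong₂ _+_ (∑-const r (n / 13)) (sym (∑-comm r r' X))) ⟩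
  n * (m / 13) + (r * (n / 13) + classCount s r r' i)  ≡⟨ +-assoc (n * (m / 13)) _ _ ⟨
  periods m n + classCount s r r' i                    ∎
  where
  r r' : ℕ
  r = m % 13
  r' = n % 13
  X : ℕ → ℕ → ℕ
  X j k = 𝟙 (ψ s j k) i
  columns : ∀ j → ∑[ k < m ] X j k ≡ m / 13 + ∑[ k < r ] X j k
  columns j = ∑-periodic-once (X j) (λ k → cong (λ x → 𝟙 x i) (ψ-periodicᵏ s j k)) (column-once s j i<13) m
  rows : ∀ k → ∑[ j < n ] X j k ≡ n / 13 + ∑[ j < r' ] X j k
  rows k = ∑-periodic-once (λ j → X j k) (λ j → cong (λ x → 𝟙 x i) (ψ-periodicʲ s j k)) (row-once s k i<13) n

residueTable : ∀ {s} → s < 13 → ∀ {r} → r < 13 → ∀ {r'} → r' < 13 →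
  min13 (classCount s r r') + δΦ r r' ≡ (r * r') / 13
residueTable = toWitness {a? = allUpTo? (λ s → allUpTo? (λ r → allUpTo? (λ r' →
  min13 (classCount s r r') + δΦ r r' ≟ (r * r') / 13) 13) 13) 13} _

/13-split : ∀ m n → (m * n) / 13 ≡ (m % 13 * (n % 13)) / 13 + periods m n
/13-split m n = begin
  (m * n) / 13                                      ≡⟨ /-congˡ mn≡r*r'+K*13 ⟩
  (r * r' + K * 13) / 13                            ≡⟨ +-distrib-/-∣ʳ (r * r') (divides K refl) ⟩
  (r * r') / 13 + (K * 13) / 13                     ≡⟨ cong (_+_ ((r * r') / 13)) (m*n/n≡m K 13) ⟩
  (r * r') / 13 + K                                 ∎
  where
  r r' K : ℕ
  r = m % 13
  r' = n % 13
  K = periods m n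
  expand : ∀ r q r' q' → (r + q * 13) * (r' + q' * 13) ≡ r * r' + ((r' + q' * 13) * q + r * q') * 13
  expand = solve-∀
  mn≡r*r'+K*13 : m * n ≡ r * r' + K * 13
  mn≡r*r'+K*13 = begin
    m * n                                                    ≡⟨ cong₂ _*_ (m≡m%n+[m/n]*n m 13) (m≡m%n+[m/n]*n n 13) ⟩
    (r + m / 13 * 13) * (r' + n / 13 * 13)                   ≡⟨ expand r (m / 13) r' (n / 13) ⟩
    r * r' + ((r' + n / 13 * 13) * (m / 13) + r * (n / 13)) * 13
      ≡⟨ cong (λ x → r * r' + (x * (m / 13) + r * (n / 13)) * 13) (m≡m%n+[m/n]*n n 13) ⟨
    r * r' + K * 13                                          ∎

δΦ-mod : ∀ m n → δΦ (m % 13) (n % 13) ≡ δΦ m n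
δΦ-mod m n = cong₂ (λ x y → if memΦ (x , y) Φ then 1 else 0) (m%n%n≡m%n m 13) (m%n%n≡m%n n 13)

mainTheorem10 : (a₀ b₀ : ℤ) (m n : ℕ) → .{{NonZero m}} → .{{NonZero n}} →
    min13 (countP a₀ b₀ m n) ≡ (m * n) / 13 ∸ δΦ m n
mainTheorem10 a₀ b₀ m n = begin
  min13 (countP a₀ b₀ m n)                         ≡⟨ minUpTo-cong 12 (λ i≤12 → reduce (s≤s i≤12)) ⟩
  minUpTo (λ i → K + classCount s r r' i) 12       ≡⟨ minUpTo-+ K (classCount s r r') 12 ⟩
  K + μ                                            ≡⟨ m+n∸n≡m (K + μ) δ ⟨
  (K + μ + δ) ∸ δ                                  ≡⟨ cong (_∸ δ) (rotate K μ δ) ⟩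
  (μ + δ + K) ∸ δ                                  ≡⟨ cong (λ x → (x + K) ∸ δ) (residueTable s<13 r<13 r'<13) ⟩
  ((r * r') / 13 + K) ∸ δ                          ≡⟨ cong₂ _∸_ (sym (/13-split m n)) (δΦ-mod m n) ⟩
  (m * n) / 13 ∸ δΦ m n                            ∎
  where
  s r r' K μ δ : ℕ
  s = φ (a₀ , b₀)
  r = m % 13
  r' = n % 13
  K = periods m n
  μ = min13 (classCount s r r')
  δ = δΦ r r'
  s<13 : s < 13
  s<13 = n%ℕd<d (+ 4 ℤ.* a₀ ℤ.+ + 7 ℤ.* b₀) 13
  r<13 : r < 13
  r<13 = m%n<n m 13
  r'<13 : r' < 13
  r'<13 = m%n<n n 13
  rotate : ∀ a b c → a + b + c ≡ b + c + a
  rotate = solve-∀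
  reduce : ∀ {i} → i < 13 → countP a₀ b₀ m n i ≡ K + classCount s r r' i
  reduce i<13 = trans (countP≡classCount a₀ b₀ m n _) (classCount-reduce s m n i<13)
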